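{- Let $p$ be a prime, $n\geq 1$ an integer, and $F_3(n)=\prod_{k=1}^n (k!)^{k!}$. Then $$\sum_{k=1}^n\left(\frac{k}{p-1}-\lfloor\log_p k\rfloor-1\right)k!\;\leq\;\nu_p\left[F_3(n)\right]\;\leq\;\sum_{k=1}^n\frac{k!\,(k-1)}{p-1}.$$
   Context: For a prime $p$ and a positive integer $m$, $\nu_p(m)=\max\{k\in\mathbb{N}: p^k\mid m\}$ denotes the $p$-adic valuation of $m$. $\lfloor x\rfloor$ is the floor function and $\log_p$ the base-$p$ logarithm. -}

module Defs where

open import Data.Nat using (ℕ; zero; suc; _+_; _*_; _^_; _≤_; _≤?_)
open import Data.Nat.Divisibility using (_∣_; _∣?_)
open import Data.Nat using (_!)
open import Relation.Nullary using (Dec; yes; no)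
open import Relation.Unary using (Pred; Decidable)
open import Level using (0ℓ)
import Data.Rational as ℚ

maxBelow : (P : Pred ℕ 0ℓ) → Decidable P → ℕ → ℕ
maxBelow P P? zero = 0
maxBelow P P? (suc b) with P? (suc b)
... | yes _ = suc b
... | no  _ = maxBelow P P? b

-- p-adic valuation: ν_p(m) = max { k : p^k ∣ m }.  For m ≥ 1 and p ≥ 2 any such
-- k satisfies k < p^k ≤ m, so searching k ≤ m gives exactly the maximum.
ν : ℕ → ℕ → ℕ
ν p m = maxBelow (λ k → p ^ k ∣ m) (λ k → p ^ k ∣? m) m

-- ⌊log_p k⌋ = max { e : p^e ≤ k } (for k ≥ 1, p ≥ 2; again e ≤ k suffices)
⌊log_⌋ : ℕ → ℕ → ℕ
⌊log_⌋ p k = maxBelow (λ e → p ^ e ≤ k) (λ e → p ^ e ≤? k) k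

prod1 : ℕ → (ℕ → ℕ) → ℕ
prod1 zero    f = 1
prod1 (suc n) f = prod1 n f * f (suc n)

sum1 : ℕ → (ℕ → ℚ.ℚ) → ℚ.ℚ
sum1 zero    f = ℚ.0ℚ
sum1 (suc n) f = sum1 n f ℚ.+ f (suc n)

F₃ : ℕ → ℕ
F₃ n = prod1 n (λ k → (k !) ^ (k !))

module Submission where

-- ν_p is additive on positive integers, so ν_p(F₃(n)) = Σ k!·ν_p(k!) and it suffices to bound
-- each ν_p(k!). Writing k = pq + r with r < p, Legendre's recurrence ν_p(k!) = q + ν_p(q!)
-- allows induction on the base-p digits of k; since ⌊log_p k⌋ > ⌊log_p q⌋ when q ≥ 1, it yields
-- (p − 1)·ν_p(k!) ≤ k − 1 and k ≤ (p − 1)(ν_p(k!) + ⌊log_p k⌋ + 1). These are the bounds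
-- 1 ≤ s_p(k) ≤ (p − 1)(⌊log_p k⌋ + 1) on the base-p digit sum in (p − 1)·ν_p(k!) = k − s_p(k).

open import Defs

module MaxBelow where
  open import Data.Nat.Base using (ℕ; zero; suc; _≤_)
  open import Data.Nat.Properties using (m≤n⇒m<n∨m≡n; ≤-pred)
  open import Data.Sum.Base using (inj₁; inj₂)
  open import Level using (0ℓ)
  open import Relation.Nullary using (yes; no; contradiction)
  open import Relation.Unary using (Pred; Decidable)
  open import Relation.Binary.PropositionalEquality using (refl)

  module _ (P : Pred ℕ 0ℓ) (P? : Decidable P) where

    maxBelow-satisfies : P 0 → ∀ b → P (maxBelow P P? b)
    maxBelow-satisfies P0 zero = P0
    maxBelow-satisfies P0 (suc b) with P? (suc b)
    ... | yes Pb = Pb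
    ... | no  _  = maxBelow-satisfies P0 b

    maxBelow-maximal : ∀ {j} b → P j → j ≤ b → j ≤ maxBelow P P? b
    maxBelow-maximal zero    _  j≤0 = j≤0
    maxBelow-maximal (suc b) Pj j≤b with P? (suc b) | m≤n⇒m<n∨m≡n j≤b
    ... | yes _ | _          = j≤b
    ... | no  _ | inj₁ j<1+b = maxBelow-maximal b Pj (≤-pred j<1+b)
    ... | no ¬P | inj₂ refl  = contradiction Pj ¬P

module Valuation where
  open import Data.Nat.Base
  open import Data.Nat.Properties
  open import Data.Nat.Divisibility
  open import Data.Nat.DivMod using (_/_; _%_; m≡m%n+[m/n]*n; m%n<n; m/n<m)
  open import Data.Nat.Induction using (<-rec)
  open import Data.Nat.Primality using (Prime; prime⇒nonTrivial; euclidsLemma)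
  open import Data.Nat.Solver using (module +-*-Solver)
  open import Algebra.Properties.CommutativeSemigroup +-commutativeSemigroup using (x∙yz≈y∙xz)
  open import Algebra.Properties.CommutativeSemigroup *-commutativeSemigroup using (interchange)
  open import Data.Product.Base using (∃-syntax; _×_; _,_)
  open import Data.Sum.Base using (inj₁; inj₂)
  open import Relation.Nullary using (¬_; contradiction)
  open import Relation.Unary using (Pred)
  open import Relation.Binary.PropositionalEquality
  open +-*-Solver using (solve; _:=_; _:+_; _:*_; con)
  open MaxBelow

  p^⌊log⌋k≤k : ∀ p {k} → 1 ≤ k → p ^ ⌊log_⌋ p k ≤ k
  p^⌊log⌋k≤k p {k} 1≤k = maxBelow-satisfies (λ e → p ^ e ≤ k) (λ e → p ^ e ≤? k) 1≤k k

  [m∸1]*n+n≡m*n : ∀ m n .{{_ : NonZero m}} → (m ∸ 1) * n + n ≡ m * n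
  [m∸1]*n+n≡m*n (suc m) n = +-comm (m * n) n

  [m∸1]*n+[n∸1]≡m*n∸1 : ∀ m n .{{_ : NonZero m}} → (m ∸ 1) * n + (n ∸ 1) ≡ m * n ∸ 1
  [m∸1]*n+[n∸1]≡m*n∸1 (suc m) zero    rewrite *-zeroʳ m = refl
  [m∸1]*n+[n∸1]≡m*n∸1 (suc m) (suc n) = +-comm (m * suc n) n

  module _ {p : ℕ} .{{_ : NonTrivial p}} where

    private instance
      p≢0 : NonZero p
      p≢0 = nonTrivial⇒nonZero p

    1<p : 1 < p
    1<p = nonTrivial⇒n>1 p

    n<p^n : ∀ n → n < p ^ n
    n<p^n zero    = z<s
    n<p^n (suc n) = ≤-<-trans (n<p^n n) (^-monoʳ-< p 1<p (n<1+n n))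

    digit-rec : ∀ {ℓ} (P : Pred ℕ ℓ) → P 0 → (∀ q r → r < p → P q → P (p * q + r)) → ∀ k → P k
    digit-rec P P0 step = <-rec P go
      where
      go : ∀ k → (∀ {j} → j < k → P j) → P k
      go zero      _   = P0
      go k@(suc _) rec = subst P (sym k≡p*q+r) (step q r (m%n<n k p) (rec (m/n<m k p 1<p)))
        where
        q = k / p
        r = k % p
        k≡p*q+r : k ≡ p * q + r
        k≡p*q+r = trans (m≡m%n+[m/n]*n k p) (trans (+-comm r (q * p)) (cong (_+ r) (*-comm q p)))

    p*q≤k⇒⌊log⌋q<⌊log⌋k : ∀ {q k} → 1 ≤ q → p * q ≤ k → ⌊log_⌋ p q < ⌊log_⌋ p k
    p*q≤k⇒⌊log⌋q<⌊log⌋k {q} {k} 1≤q p*q≤k =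
      maxBelow-maximal (λ e → p ^ e ≤ k) (λ e → p ^ e ≤? k) k p^[1+l]≤k
        (≤-trans (<⇒≤ (n<p^n (suc l))) p^[1+l]≤k)
      where
      l = ⌊log_⌋ p q
      p^[1+l]≤k : p ^ suc l ≤ k
      p^[1+l]≤k = ≤-trans (*-monoʳ-≤ p (p^⌊log⌋k≤k p 1≤q)) p*q≤k

    p∤u⇒u≢0 : ∀ {u} → ¬ p ∣ u → NonZero u
    p∤u⇒u≢0 {zero}  p∤0 = contradiction (p ∣0) p∤0
    p∤u⇒u≢0 {suc _} _   = _

    p∤1 : ¬ p ∣ 1
    p∤1 p∣1 = <⇒≱ 1<p (∣⇒≤ p∣1)

    p∣p^[1+v]*u : ∀ v u → p ∣ p ^ suc v * u
    p∣p^[1+v]*u v u = ∣-trans (m∣m*n (p ^ v)) (m∣m*n u)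

    p^v*u≡p^w*u′⇒v≡w : ∀ v w {u u′} → ¬ p ∣ u → ¬ p ∣ u′ → p ^ v * u ≡ p ^ w * u′ → v ≡ w
    p^v*u≡p^w*u′⇒v≡w zero    zero    _   _    _ = refl
    p^v*u≡p^w*u′⇒v≡w zero    (suc w) p∤u _    e =
      contradiction (subst (p ∣_) (trans (sym e) (*-identityˡ _)) (p∣p^[1+v]*u w _)) p∤u
    p^v*u≡p^w*u′⇒v≡w (suc v) zero    _   p∤u′ e =
      contradiction (subst (p ∣_) (trans e (*-identityˡ _)) (p∣p^[1+v]*u v _)) p∤u′
    p^v*u≡p^w*u′⇒v≡w (suc v) (suc w) p∤u p∤u′ e = cong suc (p^v*u≡p^w*u′⇒v≡w v w p∤u p∤u′
      (*-cancelˡ-≡ _ _ p (trans (sym (*-assoc p _ _)) (trans e (*-assoc p _ _)))))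

    ν-split : ∀ m .{{_ : NonZero m}} → ∃[ u ] ¬ p ∣ u × m ≡ p ^ ν p m * u
    ν-split m with maxBelow-satisfies (λ k → p ^ k ∣ m) (λ k → p ^ k ∣? m) (1∣ m) m
    ... | divides u m≡u*p^v = u , p∤u , trans m≡u*p^v (*-comm u _)
      where
      v = ν p m
      p∤u : ¬ p ∣ u
      p∤u p∣u = n≮n v (maxBelow-maximal (λ k → p ^ k ∣ m) (λ k → p ^ k ∣? m) m p^[1+v]∣m
                                         (≤-trans (<⇒≤ (n<p^n (suc v))) (∣⇒≤ p^[1+v]∣m)))
        where
        p^[1+v]∣m : p ^ suc v ∣ m
        p^[1+v]∣m = subst (p ^ suc v ∣_) (sym m≡u*p^v) (*-monoˡ-∣ (p ^ v) p∣u)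

    ν[p^v*u]≡v : ∀ v {u} → ¬ p ∣ u → ν p (p ^ v * u) ≡ v
    ν[p^v*u]≡v v {u} p∤u with ν-split (p ^ v * u) {{m*n≢0 (p ^ v) u {{m^n≢0 p v}} {{p∤u⇒u≢0 p∤u}}}}
    ... | u′ , p∤u′ , p^v*u≡p^ν*u′ = p^v*u≡p^w*u′⇒v≡w _ v p∤u′ p∤u (sym p^v*u≡p^ν*u′)

    p∤m⇒ν[m]≡0 : ∀ {m} → ¬ p ∣ m → ν p m ≡ 0
    p∤m⇒ν[m]≡0 {m} p∤m = subst (λ x → ν p x ≡ 0) (*-identityˡ m) (ν[p^v*u]≡v 0 p∤m)

    ν[1]≡0 : ν p 1 ≡ 0
    ν[1]≡0 = p∤m⇒ν[m]≡0 p∤1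

    ν[p*m]≡1+ν[m] : ∀ m .{{_ : NonZero m}} → ν p (p * m) ≡ suc (ν p m)
    ν[p*m]≡1+ν[m] m with ν-split m
    ... | u , p∤u , m≡p^v*u = begin
      ν p (p * m)                  ≡⟨ cong (λ x → ν p (p * x)) m≡p^v*u ⟩
      ν p (p * (p ^ ν p m * u))    ≡⟨ cong (ν p) (sym (*-assoc p _ u)) ⟩
      ν p (p ^ suc (ν p m) * u)    ≡⟨ ν[p^v*u]≡v (suc (ν p m)) p∤u ⟩
      suc (ν p m)                  ∎
      where open ≡-Reasoning

  module _ {p : ℕ} (p-prime : Prime p) where

    private instance
      p-nonTrivial : NonTrivial p
      p-nonTrivial = prime⇒nonTrivial p-prime
      p≢0 : NonZero p
      p≢0 = nonTrivial⇒nonZero p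

    p∤m⇒p∤n⇒p∤m*n : ∀ {m n} → ¬ p ∣ m → ¬ p ∣ n → ¬ p ∣ m * n
    p∤m⇒p∤n⇒p∤m*n {m} {n} p∤m p∤n p∣m*n with euclidsLemma m n p-prime p∣m*n
    ... | inj₁ p∣m = p∤m p∣m
    ... | inj₂ p∣n = p∤n p∣n

    ν[m*n]≡ν[m]+ν[n] : ∀ m n .{{_ : NonZero m}} .{{_ : NonZero n}} → ν p (m * n) ≡ ν p m + ν p n
    ν[m*n]≡ν[m]+ν[n] m n with ν-split m | ν-split n
    ... | u , p∤u , m≡p^a*u | w , p∤w , n≡p^b*w =
      trans (cong (ν p) m*n≡p^[a+b]*[u*w]) (ν[p^v*u]≡v (ν p m + ν p n) (p∤m⇒p∤n⇒p∤m*n p∤u p∤w))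
      where
      open ≡-Reasoning
      a = ν p m
      b = ν p n
      m*n≡p^[a+b]*[u*w] : m * n ≡ p ^ (a + b) * (u * w)
      m*n≡p^[a+b]*[u*w] = begin
        m * n                        ≡⟨ cong₂ _*_ m≡p^a*u n≡p^b*w ⟩
        p ^ a * u * (p ^ b * w)      ≡⟨ interchange (p ^ a) u (p ^ b) w ⟩
        p ^ a * p ^ b * (u * w)      ≡⟨ cong (_* (u * w)) (sym (^-distribˡ-+-* p a b)) ⟩
        p ^ (a + b) * (u * w)        ∎

    ν[m^n]≡n*ν[m] : ∀ m n .{{_ : NonZero m}} → ν p (m ^ n) ≡ n * ν p m
    ν[m^n]≡n*ν[m] m zero    = ν[1]≡0
    ν[m^n]≡n*ν[m] m (suc n) = trans (ν[m*n]≡ν[m]+ν[n] m (m ^ n)) (cong (ν p m +_) (ν[m^n]≡n*ν[m] m n))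
      where instance _ = m^n≢0 m n

    ν[[1+n]!]≡ν[1+n]+ν[n!] : ∀ n → ν p (suc n !) ≡ ν p (suc n) + ν p (n !)
    ν[[1+n]!]≡ν[1+n]+ν[n!] n = ν[m*n]≡ν[m]+ν[n] (suc n) (n !) {{_}} {{n !≢0}}

    ν[[m+r]!]≡ν[m!] : ∀ {m} → p ∣ m → ∀ r → r < p → ν p ((m + r) !) ≡ ν p (m !)
    ν[[m+r]!]≡ν[m!] {m} _   zero    _   = cong (λ x → ν p (x !)) (+-identityʳ m)
    ν[[m+r]!]≡ν[m!] {m} p∣m (suc r) r<p = begin
      ν p ((m + suc r) !)                  ≡⟨ cong (λ x → ν p (x !)) (+-suc m r) ⟩
      ν p (suc (m + r) !)                  ≡⟨ ν[[1+n]!]≡ν[1+n]+ν[n!] (m + r) ⟩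
      ν p (suc (m + r)) + ν p ((m + r) !)  ≡⟨ cong₂ _+_ (p∤m⇒ν[m]≡0 p∤1+m+r) (ν[[m+r]!]≡ν[m!] p∣m r (<⇒≤ r<p)) ⟩
      ν p (m !)                            ∎
      where
      open ≡-Reasoning
      p∤1+m+r : ¬ p ∣ suc (m + r)
      p∤1+m+r p∣1+m+r = <⇒≱ r<p (∣⇒≤ (∣m+n∣m⇒∣n (subst (p ∣_) (sym (+-suc m r)) p∣1+m+r) p∣m))

    ν[[p*q]!]≡q+ν[q!] : ∀ q → ν p ((p * q) !) ≡ q + ν p (q !)
    ν[[p*q]!]≡q+ν[q!] zero    = cong (λ x → ν p (x !)) (*-zeroʳ p)
    ν[[p*q]!]≡q+ν[q!] (suc q) = begin
      ν p ((p * suc q) !)                  ≡⟨ cong (λ x → ν p (x !)) p*[1+q]≡1+n ⟩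
      ν p (suc n !)                        ≡⟨ ν[[1+n]!]≡ν[1+n]+ν[n!] n ⟩
      ν p (suc n) + ν p (n !)              ≡⟨ cong₂ _+_ (cong (ν p) (sym p*[1+q]≡1+n)) ν[n!]≡ν[[p*q]!] ⟩
      ν p (p * suc q) + ν p ((p * q) !)    ≡⟨ cong₂ _+_ (ν[p*m]≡1+ν[m] (suc q)) (ν[[p*q]!]≡q+ν[q!] q) ⟩
      suc (ν p (suc q) + (q + ν p (q !)))  ≡⟨ cong suc (x∙yz≈y∙xz (ν p (suc q)) q (ν p (q !))) ⟩
      suc q + (ν p (suc q) + ν p (q !))    ≡⟨ cong (suc q +_) (sym (ν[[1+n]!]≡ν[1+n]+ν[n!] q)) ⟩
      suc q + ν p (suc q !)                ∎
      where
      open ≡-Reasoning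
      n = p * q + (p ∸ 1)
      ν[n!]≡ν[[p*q]!] : ν p (n !) ≡ ν p ((p * q) !)
      ν[n!]≡ν[[p*q]!] = ν[[m+r]!]≡ν[m!] (m∣m*n q) (p ∸ 1) (≤-reflexive (suc-pred p))
      p*[1+q]≡1+n : p * suc q ≡ suc n
      p*[1+q]≡1+n = begin
        p * suc q             ≡⟨ *-suc p q ⟩
        p + p * q             ≡⟨ +-comm p (p * q) ⟩
        p * q + p             ≡⟨ cong (p * q +_) (sym (suc-pred p)) ⟩
        p * q + suc (p ∸ 1)   ≡⟨ +-suc (p * q) (p ∸ 1) ⟩
        suc n                 ∎

    ν[[p*q+r]!]≡q+ν[q!] : ∀ q r → r < p → ν p ((p * q + r) !) ≡ q + ν p (q !)
    ν[[p*q+r]!]≡q+ν[q!] q r r<p = trans (ν[[m+r]!]≡ν[m!] (m∣m*n q) r r<p) (ν[[p*q]!]≡q+ν[q!] q)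

    [p∸1]*ν[k!]≤k∸1 : ∀ k → (p ∸ 1) * ν p (k !) ≤ k ∸ 1
    [p∸1]*ν[k!]≤k∸1 = digit-rec (λ k → (p ∸ 1) * ν p (k !) ≤ k ∸ 1)
                                (≤-reflexive (trans (cong ((p ∸ 1) *_) ν[1]≡0) (*-zeroʳ (p ∸ 1))))
                                step
      where
      step : ∀ q r → r < p → (p ∸ 1) * ν p (q !) ≤ q ∸ 1 → (p ∸ 1) * ν p ((p * q + r) !) ≤ p * q + r ∸ 1
      step q r r<p ih = begin
        (p ∸ 1) * ν p ((p * q + r) !)      ≡⟨ cong ((p ∸ 1) *_) (ν[[p*q+r]!]≡q+ν[q!] q r r<p) ⟩
        (p ∸ 1) * (q + ν p (q !))          ≡⟨ *-distribˡ-+ (p ∸ 1) q (ν p (q !)) ⟩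
        (p ∸ 1) * q + (p ∸ 1) * ν p (q !)  ≤⟨ +-monoʳ-≤ ((p ∸ 1) * q) ih ⟩
        (p ∸ 1) * q + (q ∸ 1)              ≡⟨ [m∸1]*n+[n∸1]≡m*n∸1 p q ⟩
        p * q ∸ 1                          ≤⟨ ∸-monoˡ-≤ 1 (m≤m+n (p * q) r) ⟩
        p * q + r ∸ 1                      ∎
        where open ≤-Reasoning

    k≤[p∸1]*[1+ν[k!]+⌊log⌋k] : ∀ k → k ≤ (p ∸ 1) * suc (ν p (k !) + ⌊log_⌋ p k)
    k≤[p∸1]*[1+ν[k!]+⌊log⌋k] = digit-rec (λ k → k ≤ (p ∸ 1) * suc (ν p (k !) + ⌊log_⌋ p k)) z≤n step
      where
      open ≤-Reasoning
      c = p ∸ 1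
      step : ∀ q r → r < p → q ≤ c * suc (ν p (q !) + ⌊log_⌋ p q) →
             p * q + r ≤ c * suc (ν p ((p * q + r) !) + ⌊log_⌋ p (p * q + r))
      step zero r r<p _ = begin
        p * 0 + r   ≡⟨ cong (_+ r) (*-zeroʳ p) ⟩
        r           ≤⟨ <⇒≤pred r<p ⟩
        c           ≤⟨ m≤m*n c (suc _) ⟩
        c * suc _   ∎
      step q@(suc _) r r<p ih = begin
        p * q + r                         ≤⟨ +-monoʳ-≤ (p * q) (<⇒≤pred r<p) ⟩
        p * q + c                         ≡⟨ cong (_+ c) ([m∸1]*n+n≡m*n p q) ⟨
        c * q + q + c                     ≤⟨ +-monoˡ-≤ c (+-monoʳ-≤ (c * q) ih) ⟩
        c * q + c * suc (v + l) + c       ≡⟨ solve 4 (λ c q v l → c :* q :+ c :* (con 1 :+ (v :+ l)) :+ c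
                                                                := c :* (con 1 :+ (q :+ v :+ (con 1 :+ l))))
                                                     refl c q v l ⟩
        c * suc (q + v + suc l)           ≤⟨ *-monoʳ-≤ c (s≤s (+-monoʳ-≤ (q + v) l<⌊log⌋k)) ⟩
        c * suc (q + v + ⌊log_⌋ p k)      ≡⟨ cong (λ x → c * suc (x + ⌊log_⌋ p k)) (ν[[p*q+r]!]≡q+ν[q!] q r r<p) ⟨
        c * suc (ν p (k !) + ⌊log_⌋ p k)  ∎
        where
        k = p * q + r
        v = ν p (q !)
        l = ⌊log_⌋ p q
        l<⌊log⌋k : l < ⌊log_⌋ p k
        l<⌊log⌋k = p*q≤k⇒⌊log⌋q<⌊log⌋k (s≤s z≤n) (m≤m+n (p * q) r)

module Rational where
  open import Data.Nat.Base as ℕ using (ℕ; zero; suc; NonZero; pred)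
  import Data.Nat.Properties as ℕ
  open import Data.Integer.Base as ℤ using (+_)
  import Data.Integer.Properties as ℤ
  open import Data.Rational.Base using (ℚ; _/_; _+_; _-_; _*_; -_; _≤_; 1ℚ; toℚᵘ)
  open import Data.Rational.Properties
  open import Data.Rational.Unnormalised.Base as ℚᵘ using (mkℚᵘ; *≡*; *≤*)
  import Data.Rational.Unnormalised.Properties as ℚᵘ
  open import Data.Rational.Solver using (module +-*-Solver)
  open import Relation.Binary.PropositionalEquality
  open +-*-Solver using (solve; _:=_; _:+_; _:-_)

  fromℕ : ℕ → ℚ
  fromℕ n = + n / 1

  toℚᵘ-/ : ∀ n d .{{_ : NonZero d}} → toℚᵘ (+ n / d) ℚᵘ.≃ mkℚᵘ (+ n) (pred d)
  toℚᵘ-/ n (suc d) = toℚᵘ-fromℚᵘ (mkℚᵘ (+ n) d)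

  *≤*⇒/≤/ : ∀ m n c d .{{_ : NonZero c}} .{{_ : NonZero d}} →
            m ℕ.* d ℕ.≤ n ℕ.* c → + m / c ≤ + n / d
  *≤*⇒/≤/ m n c@(suc _) d@(suc _) md≤nc = toℚᵘ-cancel-≤ (begin
    toℚᵘ (+ m / c)        ≃⟨ toℚᵘ-/ m c ⟩
    mkℚᵘ (+ m) (pred c)   ≤⟨ *≤* (subst₂ ℤ._≤_ (ℤ.pos-* m d) (ℤ.pos-* n c) (ℤ.+≤+ md≤nc)) ⟩
    mkℚᵘ (+ n) (pred d)   ≃⟨ toℚᵘ-/ n d ⟨
    toℚᵘ (+ n / d)        ∎)
    where open ℚᵘ.≤-Reasoning

  fromℕ-+ : ∀ m n → fromℕ (m ℕ.+ n) ≡ fromℕ m + fromℕ n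
  fromℕ-+ m n = toℚᵘ-injective (begin
    toℚᵘ (fromℕ (m ℕ.+ n))                 ≈⟨ toℚᵘ-/ (m ℕ.+ n) 1 ⟩
    mkℚᵘ (+ (m ℕ.+ n)) 0                    ≈⟨ *≡* (cong (ℤ._* + 1) +[m+n]≡+m*1++n*1) ⟩
    mkℚᵘ (+ m) 0 ℚᵘ.+ mkℚᵘ (+ n) 0          ≈⟨ ℚᵘ.+-cong (toℚᵘ-/ m 1) (toℚᵘ-/ n 1) ⟨
    toℚᵘ (fromℕ m) ℚᵘ.+ toℚᵘ (fromℕ n)      ≈⟨ toℚᵘ-homo-+ (fromℕ m) (fromℕ n) ⟨
    toℚᵘ (fromℕ m + fromℕ n)                ∎)
    where
    open ℚᵘ.≃-Reasoning
    +[m+n]≡+m*1++n*1 : + (m ℕ.+ n) ≡ + m ℤ.* + 1 ℤ.+ + n ℤ.* + 1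
    +[m+n]≡+m*1++n*1 = trans (ℤ.pos-+ m n) (sym (cong₂ ℤ._+_ (ℤ.*-identityʳ (+ m)) (ℤ.*-identityʳ (+ n))))

  fromℕ-* : ∀ m n → fromℕ (m ℕ.* n) ≡ fromℕ m * fromℕ n
  fromℕ-* m n = toℚᵘ-injective (begin
    toℚᵘ (fromℕ (m ℕ.* n))                 ≈⟨ toℚᵘ-/ (m ℕ.* n) 1 ⟩
    mkℚᵘ (+ (m ℕ.* n)) 0                    ≈⟨ *≡* (cong (ℤ._* + 1) (ℤ.pos-* m n)) ⟩
    mkℚᵘ (+ m) 0 ℚᵘ.* mkℚᵘ (+ n) 0          ≈⟨ ℚᵘ.*-cong (toℚᵘ-/ m 1) (toℚᵘ-/ n 1) ⟨
    toℚᵘ (fromℕ m) ℚᵘ.* toℚᵘ (fromℕ n)      ≈⟨ toℚᵘ-homo-* (fromℕ m) (fromℕ n) ⟨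
    toℚᵘ (fromℕ m * fromℕ n)                ∎)
    where open ℚᵘ.≃-Reasoning

  sum1-mono-≤ : ∀ n {f g : ℕ → ℚ} → (∀ k → f k ≤ g k) → sum1 n f ≤ sum1 n g
  sum1-mono-≤ zero    f≤g = ≤-refl
  sum1-mono-≤ (suc n) f≤g = +-mono-≤ (sum1-mono-≤ n f≤g) (f≤g (suc n))

  lower-summand-≤ : ∀ {k c v l} .{{_ : NonZero c}} x → k ℕ.≤ c ℕ.* suc (v ℕ.+ l) →
                    (+ k / c - fromℕ l - 1ℚ) * fromℕ x ≤ fromℕ (x ℕ.* v)
  lower-summand-≤ {k} {c} {v} {l} x k≤c*[1+v+l] = begin
    (+ k / c - fromℕ l - 1ℚ) * fromℕ x   ≤⟨ *-monoʳ-≤-nonNeg (fromℕ x) {{normalize-nonNeg x 1}} k/c-l-1≤v ⟩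
    fromℕ v * fromℕ x                    ≡⟨ *-comm (fromℕ v) (fromℕ x) ⟩
    fromℕ x * fromℕ v                    ≡⟨ fromℕ-* x v ⟨
    fromℕ (x ℕ.* v)                      ∎
    where
    open ≤-Reasoning
    k/c≤1+v+l : + k / c ≤ fromℕ (suc (v ℕ.+ l))
    k/c≤1+v+l = *≤*⇒/≤/ k (suc (v ℕ.+ l)) c 1
                  (subst₂ ℕ._≤_ (sym (ℕ.*-identityʳ k)) (ℕ.*-comm c _) k≤c*[1+v+l])
    fromℕ[1+v+l] : fromℕ (suc (v ℕ.+ l)) ≡ 1ℚ + (fromℕ v + fromℕ l)
    fromℕ[1+v+l] = trans (fromℕ-+ 1 (v ℕ.+ l)) (cong (λ y → 1ℚ + y) (fromℕ-+ v l))
    k/c-l-1≤v : + k / c - fromℕ l - 1ℚ ≤ fromℕ v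
    k/c-l-1≤v = begin
      + k / c - fromℕ l - 1ℚ                    ≤⟨ +-monoˡ-≤ (- 1ℚ) (+-monoˡ-≤ (- fromℕ l) k/c≤1+v+l) ⟩
      fromℕ (suc (v ℕ.+ l)) - fromℕ l - 1ℚ      ≡⟨ cong (λ y → y - fromℕ l - 1ℚ) fromℕ[1+v+l] ⟩
      1ℚ + (fromℕ v + fromℕ l) - fromℕ l - 1ℚ   ≡⟨ solve 3 (λ o v l → o :+ (v :+ l) :- l :- o := v) refl 1ℚ (fromℕ v) (fromℕ l) ⟩
      fromℕ v                                   ∎

  upper-summand-≤ : ∀ {c v m} .{{_ : NonZero c}} x → c ℕ.* v ℕ.≤ m →
                    fromℕ (x ℕ.* v) ≤ + (x ℕ.* m) / c
  upper-summand-≤ {c} {v} {m} x c*v≤m = *≤*⇒/≤/ (x ℕ.* v) (x ℕ.* m) 1 c (begin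
    x ℕ.* v ℕ.* c      ≡⟨ ℕ.*-assoc x v c ⟩
    x ℕ.* (v ℕ.* c)    ≡⟨ cong (x ℕ.*_) (ℕ.*-comm v c) ⟩
    x ℕ.* (c ℕ.* v)    ≤⟨ ℕ.*-monoʳ-≤ x c*v≤m ⟩
    x ℕ.* m            ≡⟨ ℕ.*-identityʳ (x ℕ.* m) ⟨
    x ℕ.* m ℕ.* 1      ∎)
    where open ℕ.≤-Reasoning

module F₃Valuation where
  open import Data.Nat.Base as ℕ using (ℕ; zero; suc; NonZero; _!)
  import Data.Nat.Properties as ℕ
  open import Data.Nat.Primality using (Prime; prime⇒nonTrivial)
  open import Data.Rational.Base using (_+_)
  open import Relation.Binary.PropositionalEquality
  open Valuation
  open Rational using (fromℕ; fromℕ-+)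

  F₃≢0 : ∀ n → NonZero (F₃ n)
  F₃≢0 zero    = _
  F₃≢0 (suc n) = ℕ.m*n≢0 (F₃ n) _ {{F₃≢0 n}} {{ℕ.m^n≢0 (suc n !) (suc n !) {{suc n ℕ.!≢0}}}}

  ν[F₃n]≡Σk!*ν[k!] : ∀ {p} → Prime p → ∀ n →
                     fromℕ (ν p (F₃ n)) ≡ sum1 n (λ k → fromℕ (k ! ℕ.* ν p (k !)))
  ν[F₃n]≡Σk!*ν[k!] p-prime zero    = cong fromℕ (ν[1]≡0 {{prime⇒nonTrivial p-prime}})
  ν[F₃n]≡Σk!*ν[k!] {p} p-prime (suc n) = begin
    fromℕ (ν p (F₃ n ℕ.* x ℕ.^ x))             ≡⟨ cong fromℕ (ν[m*n]≡ν[m]+ν[n] p-prime (F₃ n) (x ℕ.^ x)) ⟩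
    fromℕ (ν p (F₃ n) ℕ.+ ν p (x ℕ.^ x))       ≡⟨ cong (λ y → fromℕ (ν p (F₃ n) ℕ.+ y)) (ν[m^n]≡n*ν[m] p-prime x x) ⟩
    fromℕ (ν p (F₃ n) ℕ.+ x ℕ.* ν p x)         ≡⟨ fromℕ-+ (ν p (F₃ n)) (x ℕ.* ν p x) ⟩
    fromℕ (ν p (F₃ n)) + fromℕ (x ℕ.* ν p x)   ≡⟨ cong (_+ fromℕ (x ℕ.* ν p x)) (ν[F₃n]≡Σk!*ν[k!] p-prime n) ⟩
    sum1 n (λ k → fromℕ (k ! ℕ.* ν p (k !))) + fromℕ (x ℕ.* ν p x) ∎
    where
    open ≡-Reasoning
    x = suc n !
    instance
      _ = F₃≢0 n
      _ = suc n ℕ.!≢0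
      _ = ℕ.m^n≢0 x x

open import Data.Nat using (ℕ; _≥_; _∸_; NonZero)
import Data.Nat
open import Data.Nat.Primality using (Prime)
open import Data.Nat using (_!)
open import Data.Product using (_×_)
open import Data.Rational using (ℚ; _/_; _+_; _-_; _*_; _≤_; 1ℚ)
open import Data.Integer using (+_)

open import Data.Product using (_,_)
open import Data.Rational.Properties using (≤-trans; ≤-reflexive)
open import Relation.Binary.PropositionalEquality using (sym)
open Valuation using ([p∸1]*ν[k!]≤k∸1; k≤[p∸1]*[1+ν[k!]+⌊log⌋k])
open Rational using (sum1-mono-≤; lower-summand-≤; upper-summand-≤)
open F₃Valuation using (ν[F₃n]≡Σk!*ν[k!])

mainTheorem9 : (p n : ℕ) → .{{_ : NonZero (p ∸ 1)}} → Prime p → n ≥ 1 →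
  (sum1 n (λ k → ((+ k / (p ∸ 1)) - (+ (⌊log_⌋ p k) / 1) - 1ℚ) * (+ (k !) / 1))
    ≤ (+ (ν p (F₃ n)) / 1))
  × ((+ (ν p (F₃ n)) / 1)
    ≤ sum1 n (λ k → + ((k !) Data.Nat.* (k ∸ 1)) / (p ∸ 1)))
mainTheorem9 p n p-prime _ =
    ≤-trans (sum1-mono-≤ n λ k → lower-summand-≤ (k !) (k≤[p∸1]*[1+ν[k!]+⌊log⌋k] p-prime k))
            (≤-reflexive (sym (ν[F₃n]≡Σk!*ν[k!] p-prime n)))
  , ≤-trans (≤-reflexive (ν[F₃n]≡Σk!*ν[k!] p-prime n))
            (sum1-mono-≤ n λ k → upper-summand-≤ (k !) ([p∸1]*ν[k!]≤k∸1 p-prime k))
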